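{- For every word $w$ of length $n\ge1$ over a finite alphabet and every positive integer $p$, $$\sum_{r\in \mathrm{MR}(w),\ \pi(r)\le p}\bigl(e(r)-1\bigr)\le n(\ln(p)+1).$$
   Context: For a nonempty word $u$, its (minimal) period $\pi(u)$ is the least positive integer $p$ such that $u[i]=u[i+p]$ whenever positions $i$ and $i+p$ both exist in $u$; its exponent is $e(u)=|u|/\pi(u)$. For a word $w$ of length $n$, a maximal repetition in $w$ is an occurrence $w[i..j]$ ($1\le i\le j\le n$, distinct occurrences counted separately, i.e. identified by the pair $(i,j)$) such that $\pi(w[i..j])>\pi(w[i-1..j])$ whenever $i\neq 1$, and $\pi(w[i..j])>\pi(w[i..j+1])$ whenever $j\neq n$. $\mathrm{MR}(w)$ denotes the set of maximal repetitions in $w$ whose exponent is strictly greater than $1$. $\ln$ is the natural logarithm. -}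

module Defs where

open import Data.Nat as ℕ using (ℕ; zero; suc; _∸_; _≤ᵇ_; _<ᵇ_; _!)
open import Data.Nat.Properties using (_!≢0)
open import Data.Bool using (Bool; true; false; if_then_else_; _∧_; not)
open import Data.Fin using (Fin)
import Data.Fin.Properties as FinP
open import Data.List using (List; []; _∷_; length; take; drop; upTo; map; concatMap; filter; foldr)
open import Data.Maybe using (Maybe; nothing; just)
import Data.Maybe.Properties as MaybeP
open import Data.Integer using (+_)
open import Data.Rational using (ℚ; _/_; _+_; _-_; _*_; _≤_; 0ℚ; 1ℚ)
open import Data.Product using (_×_; _,_)
open import Data.Sum using (_⊎_)
open import Relation.Nullary.Decidable using (⌊_⌋)

-- Words over the finite alphabet Fin k are lists; positions are 0-indexed here
-- (the paper's 1-indexed w[i..j] corresponds to our factor w (i-1) (j-1)).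

at : ∀ {k} → List (Fin k) → ℕ → Maybe (Fin k)
at []       _       = nothing
at (x ∷ xs) zero    = just x
at (x ∷ xs) (suc t) = at xs t

factor : ∀ {k} → List (Fin k) → ℕ → ℕ → List (Fin k)
factor w i j = take (suc j ∸ i) (drop i w)

isPeriod : ∀ {k} → List (Fin k) → ℕ → Bool
isPeriod u p = foldr (λ t b → b ∧ ⌊ MaybeP.≡-dec FinP._≟_ (at u t) (at u (t ℕ.+ p)) ⌋) true (upTo (length u ∸ p))

periodSearch : ∀ {k} → List (Fin k) → ℕ → ℕ → ℕ
periodSearch u q zero    = q
periodSearch u q (suc f) = if isPeriod u (suc q) then q else periodSearch u (suc q) f

-- minimal period π(u) (for nonempty u; |u| is always a period, so the search
-- over 1..|u| succeeds).  Written as a successor so that it is visibly nonzero.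
period : ∀ {k} → List (Fin k) → ℕ
period u = suc (periodSearch u 0 (length u))

exponent : ∀ {k} → List (Fin k) → ℚ
exponent u = (+ length u) / period u

isMR : ∀ {k} → List (Fin k) → ℕ × ℕ → Bool
isMR w (i , j) =
  (i ≤ᵇ j) ∧ (suc j ≤ᵇ length w)
  ∧ leftMax i ∧ rightMax
  ∧ (period (factor w i j) <ᵇ length (factor w i j))
  where
    leftMax : ℕ → Bool
    leftMax zero    = true
    leftMax (suc i') = period (factor w i j) <ᵇ period (factor w i' j)
    rightMax : Bool
    rightMax = if suc j ℕ.≡ᵇ length w then true
               else (period (factor w i j) <ᵇ period (factor w i (suc j)))

MR : ∀ {k} → List (Fin k) → List (ℕ × ℕ)
MR w = filter (λ r → isMR w r Data.Bool.≟ true)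
         (concatMap (λ i → map (λ j → (i , j)) (upTo (length w))) (upTo (length w)))
  where import Data.Bool

sumMR : ∀ {k} → List (Fin k) → ℕ → ℚ
sumMR w p = foldr (λ { (i , j) acc →
                 if period (factor w i j) ≤ᵇ p
                 then (exponent (factor w i j) - 1ℚ) + acc
                 else acc }) 0ℚ (MR w)

-- Real-number bound encoded with rationals.
-- x ^ k and the partial sums Σ_{m<N} x^m / m! of the exponential series.
pow : ℚ → ℕ → ℚ
pow x zero    = 1ℚ
pow x (suc m) = x * pow x m

expPartial : ℚ → ℕ → ℚ
expPartial x zero    = 0ℚ
expPartial x (suc N) = expPartial x N + (pow x N * ((+ 1) / (N !)))
  where instance _ = N !≢0

-- x ≤ ln p (for p ≥ 1):  if x ≤ 0 this holds since ln p ≥ 0;  if x > 0 the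
-- partial sums of exp x increase to exp x, so exp x ≤ p iff all are ≤ p.
_≤ln_ : ℚ → ℕ → Set
x ≤ln p = (x ≤ 0ℚ) ⊎ (∀ N → expPartial x N ≤ ((+ p) / 1))

-- S ≤ n (ln p + 1)  for p ≥ 1, n ≥ 1:  equivalently S/n - 1 ≤ ln p.
BoundLn : ℚ → (n : ℕ) → .{{_ : ℕ.NonZero n}} → ℕ → Set
BoundLn S n p = ((S * ((+ 1) / n)) - 1ℚ) ≤ln p

module Submission where

-- A maximal repetition r of period q = π(r) contains |r| − q windows [t, t + q], and
-- e(r) − 1 = (|r| − q)/q. Two maximal repetitions of the same period q sharing a window
-- coincide: their union is still q-periodic, so the one that is a proper part of it would
-- not be maximal. Hence each position t starts a window of at most one maximal repetition
-- of each period q, those of period q contribute at most n/q, and the whole sum is at most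
-- n·H_p with H_p = 1 + 1/2 + ⋯ + 1/p.
--
-- The logarithm is encoded through the partial sums E_N of the exponential series, so
-- H_p − 1 ≤ ln p becomes E_N(H_p − 1) ≤ p. This follows by induction on p from the
-- mean-value inequality E_{N+1}(x) ≤ E_{N+1}(y) + (x − y)·E_N(x) for 0 ≤ y ≤ x, applied
-- with y = H_p − 1 and x − y ≤ H_{p+1} − H_p = 1/(p + 1).

open import Defs
open import Data.Nat using (ℕ; suc)
import Data.Nat as ℕ
open import Data.Fin using (Fin)
open import Data.List using (List; []; _∷_; length; upTo)

import Data.Nat.Properties as ℕP
import Data.Rational.Properties as ℚP
open import Algebra.Core using (Op₂)
open import Algebra.Structures using (IsCommutativeMonoid)
open import Relation.Binary.PropositionalEquality
  using (_≡_; _≢_; refl; sym; trans; cong; cong₂; subst; subst₂; module ≡-Reasoning)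

module Fraction where
  open import Data.Nat as ℕ using (NonZero)
  open import Data.Integer as ℤ using (+_)
  import Data.Integer.Properties as ℤP
  open import Data.Rational using (ℚ; _/_; _+_; _-_; -_; _*_; _≤_; 0ℚ; 1ℚ; toℚᵘ)
  open import Data.Nat.Solver using (module +-*-Solver)
  open +-*-Solver using (solve; _:*_; _:+_; con; _:=_)
  open import Data.Rational.Unnormalised using (mkℚᵘ; *≡*; *≤*; _≃_)
  import Data.Rational.Unnormalised.Properties as ℚᵘP

  private
    toℚᵘ-/ : ∀ a m .{{_ : NonZero m}} → toℚᵘ ((+ a) / m) ≃ mkℚᵘ (+ a) (ℕ.pred m)
    toℚᵘ-/ a (suc m) = ℚP.toℚᵘ-fromℚᵘ (mkℚᵘ (+ a) m)

    pos-*-≡ : ∀ a b c d → a ℕ.* d ≡ c ℕ.* b → (+ a) ℤ.* (+ d) ≡ (+ c) ℤ.* (+ b)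
    pos-*-≡ a b c d eq = trans (sym (ℤP.pos-* a d)) (trans (cong +_ eq) (ℤP.pos-* c b))

  /≤/ : ∀ a b c d .{{_ : NonZero b}} .{{_ : NonZero d}} →
        a ℕ.* d ℕ.≤ c ℕ.* b → (+ a) / b ≤ (+ c) / d
  /≤/ a b@(suc _) c d@(suc _) le = ℚP.toℚᵘ-cancel-≤
    (ℚᵘP.≤-respˡ-≃ (ℚᵘP.≃-sym (toℚᵘ-/ a b)) (ℚᵘP.≤-respʳ-≃ (ℚᵘP.≃-sym (toℚᵘ-/ c d))
      (*≤* (subst₂ ℤ._≤_ (ℤP.pos-* a d) (ℤP.pos-* c b) (ℤ.+≤+ le)))))

  /+/≡/ : ∀ a b c d e f .{{_ : NonZero b}} .{{_ : NonZero d}} .{{_ : NonZero f}} →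
          (a ℕ.* d ℕ.+ c ℕ.* b) ℕ.* f ≡ e ℕ.* (b ℕ.* d) → (+ a) / b + (+ c) / d ≡ (+ e) / f
  /+/≡/ a b@(suc _) c d@(suc _) e f@(suc _) eq = ℚP.toℚᵘ-injective
    (ℚᵘP.≃-trans (ℚP.toℚᵘ-homo-+ ((+ a) / b) ((+ c) / d))
    (ℚᵘP.≃-trans (ℚᵘP.+-cong (toℚᵘ-/ a b) (toℚᵘ-/ c d))
    (ℚᵘP.≃-trans (*≡* cross) (ℚᵘP.≃-sym (toℚᵘ-/ e f)))))
    where
    cross : ((+ a) ℤ.* (+ d) ℤ.+ (+ c) ℤ.* (+ b)) ℤ.* (+ f) ≡ (+ e) ℤ.* (+ (b ℕ.* d))
    cross = trans (cong (ℤ._* (+ f)) (trans (cong₂ ℤ._+_ (sym (ℤP.pos-* a d)) (sym (ℤP.pos-* c b)))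
                                             (sym (ℤP.pos-+ (a ℕ.* d) (c ℕ.* b)))))
                  (pos-*-≡ (a ℕ.* d ℕ.+ c ℕ.* b) (b ℕ.* d) e f eq)

  /*/≡/ : ∀ a b c d e f .{{_ : NonZero b}} .{{_ : NonZero d}} .{{_ : NonZero f}} →
          (a ℕ.* c) ℕ.* f ≡ e ℕ.* (b ℕ.* d) → (+ a) / b * ((+ c) / d) ≡ (+ e) / f
  /*/≡/ a b@(suc _) c d@(suc _) e f@(suc _) eq = ℚP.toℚᵘ-injective
    (ℚᵘP.≃-trans (ℚP.toℚᵘ-homo-* ((+ a) / b) ((+ c) / d))
    (ℚᵘP.≃-trans (ℚᵘP.*-cong (toℚᵘ-/ a b) (toℚᵘ-/ c d))
    (ℚᵘP.≃-trans (*≡* cross) (ℚᵘP.≃-sym (toℚᵘ-/ e f)))))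
    where
    cross : ((+ a) ℤ.* (+ c)) ℤ.* (+ f) ≡ (+ e) ℤ.* (+ (b ℕ.* d))
    cross = trans (cong (ℤ._* (+ f)) (sym (ℤP.pos-* a c))) (pos-*-≡ (a ℕ.* c) (b ℕ.* d) e f eq)

  0≤1/n : ∀ n .{{_ : NonZero n}} → 0ℚ ≤ (+ 1) / n
  0≤1/n n = /≤/ 0 1 1 n ℕ.z≤n

  n/1+1≡[1+n]/1 : ∀ n → (+ n) / 1 + 1ℚ ≡ (+ suc n) / 1
  n/1+1≡[1+n]/1 n = /+/≡/ n 1 1 1 (suc n) 1
    (solve 1 (λ n → (n :* con 1 :+ con 1 :* con 1) :* con 1 := (con 1 :+ n) :* (con 1 :* con 1)) refl n)

  [1+n]/1*1/[1+n]≡1 : ∀ n → (+ suc n) / 1 * ((+ 1) / suc n) ≡ 1ℚ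
  [1+n]/1*1/[1+n]≡1 n = /*/≡/ (suc n) 1 1 (suc n) 1 1
    (solve 1 (λ n → ((con 1 :+ n) :* con 1) :* con 1 := con 1 :* (con 1 :* (con 1 :+ n))) refl n)

  [L∸q]/q≡L/q-1 : ∀ L q .{{_ : NonZero q}} → q ℕ.≤ L → (+ (L ℕ.∸ q)) / q ≡ (+ L) / q - 1ℚ
  [L∸q]/q≡L/q-1 L q@(suc _) q≤L = begin
    (+ (L ℕ.∸ q)) / q                     ≡⟨ sym (ℚP.+-identityʳ _) ⟩
    (+ (L ℕ.∸ q)) / q + 0ℚ                ≡⟨ cong (λ z → (+ (L ℕ.∸ q)) / q + z) (sym (ℚP.+-inverseʳ 1ℚ)) ⟩
    (+ (L ℕ.∸ q)) / q + (1ℚ - 1ℚ)         ≡⟨ sym (ℚP.+-assoc ((+ (L ℕ.∸ q)) / q) 1ℚ (- 1ℚ)) ⟩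
    ((+ (L ℕ.∸ q)) / q + (+ 1) / 1) - 1ℚ  ≡⟨ cong (_- 1ℚ) (/+/≡/ (L ℕ.∸ q) q 1 1 L q cross) ⟩
    (+ L) / q - 1ℚ                        ∎
    where
    open ≡-Reasoning
    cross : ((L ℕ.∸ q) ℕ.* 1 ℕ.+ 1 ℕ.* q) ℕ.* q ≡ L ℕ.* (q ℕ.* 1)
    cross rewrite ℕP.*-identityʳ (L ℕ.∸ q) | ℕP.*-identityˡ q | ℕP.*-identityʳ q | ℕP.m∸n+n≡m q≤L = refl

module ListSum {A : Set} {_+_ : Op₂ A} {0# : A} (isCM : IsCommutativeMonoid _≡_ _+_ 0#) where
  open IsCommutativeMonoid isCM using (assoc; identityˡ; identityʳ; isCommutativeSemigroup)
  open import Algebra.Bundles using (CommutativeSemigroup)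
  open import Level using (0ℓ)

  private
    +-commutativeSemigroup : CommutativeSemigroup 0ℓ 0ℓ
    +-commutativeSemigroup = record { isCommutativeSemigroup = isCommutativeSemigroup }

  open import Algebra.Properties.CommutativeSemigroup +-commutativeSemigroup using (interchange)
  open import Data.List using ([]; _++_; [_]; map; concatMap; upTo)
  open import Data.List.Membership.Propositional using (_∈_)
  open import Data.List.Relation.Unary.Any using (here; there)
  import Data.List.Properties as ListP
  open ≡-Reasoning

  ∑ : {B : Set} → List B → (B → A) → A
  ∑ []       f = 0#
  ∑ (x ∷ xs) f = f x + ∑ xs f

  private variable B C : Set

  ∑-cong : ∀ (xs : List B) {f g} → (∀ x → f x ≡ g x) → ∑ xs f ≡ ∑ xs g
  ∑-cong []       f≗g = refl
  ∑-cong (x ∷ xs) f≗g = cong₂ _+_ (f≗g x) (∑-cong xs f≗g)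

  ∑-zero : ∀ (xs : List B) {f} → (∀ {x} → x ∈ xs → f x ≡ 0#) → ∑ xs f ≡ 0#
  ∑-zero []       f≗0 = refl
  ∑-zero (x ∷ xs) f≗0 = trans (cong₂ _+_ (f≗0 (here refl)) (∑-zero xs (λ x∈xs → f≗0 (there x∈xs)))) (identityˡ 0#)

  ∑-++ : ∀ (xs ys : List B) f → ∑ (xs ++ ys) f ≡ ∑ xs f + ∑ ys f
  ∑-++ []       ys f = sym (identityˡ (∑ ys f))
  ∑-++ (x ∷ xs) ys f = trans (cong (f x +_) (∑-++ xs ys f)) (sym (assoc (f x) _ _))

  ∑-distrib-+ : ∀ (xs : List B) f g → ∑ xs (λ x → f x + g x) ≡ ∑ xs f + ∑ xs g
  ∑-distrib-+ []       f g = sym (identityˡ 0#)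
  ∑-distrib-+ (x ∷ xs) f g = begin
    (f x + g x) + ∑ xs (λ x → f x + g x) ≡⟨ cong ((f x + g x) +_) (∑-distrib-+ xs f g) ⟩
    (f x + g x) + (∑ xs f + ∑ xs g)       ≡⟨ interchange (f x) (g x) (∑ xs f) (∑ xs g) ⟩
    (f x + ∑ xs f) + (g x + ∑ xs g)       ∎

  ∑-comm : ∀ (xs : List B) (ys : List C) (f : B → C → A) →
           ∑ xs (λ x → ∑ ys (f x)) ≡ ∑ ys (λ y → ∑ xs (λ x → f x y))
  ∑-comm []       ys f = sym (∑-zero ys (λ _ → refl))
  ∑-comm (x ∷ xs) ys f = trans (cong (∑ ys (f x) +_) (∑-comm xs ys f))
                               (sym (∑-distrib-+ ys (f x) (λ y → ∑ xs (λ x → f x y))))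

  ∑-concatMap : ∀ (g : C → List B) (zs : List C) f →
                ∑ (concatMap g zs) f ≡ ∑ zs (λ z → ∑ (g z) f)
  ∑-concatMap g []       f = refl
  ∑-concatMap g (z ∷ zs) f = trans (∑-++ (g z) (concatMap g zs) f) (cong (∑ (g z) f +_) (∑-concatMap g zs f))

  ∑-map : ∀ (g : C → B) (zs : List C) f → ∑ (map g zs) f ≡ ∑ zs (λ z → f (g z))
  ∑-map g []       f = refl
  ∑-map g (z ∷ zs) f = cong (f (g z) +_) (∑-map g zs f)

  ∑-upTo-suc : ∀ m f → ∑ (upTo (suc m)) f ≡ ∑ (upTo m) f + f m
  ∑-upTo-suc m f = begin
    ∑ (upTo (suc m)) f          ≡⟨ cong (λ xs → ∑ xs f) (sym (ListP.upTo-∷ʳ m)) ⟩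
    ∑ (upTo m ++ [ m ]) f       ≡⟨ ∑-++ (upTo m) [ m ] f ⟩
    ∑ (upTo m) f + (f m + 0#)   ≡⟨ cong (∑ (upTo m) f +_) (identityʳ (f m)) ⟩
    ∑ (upTo m) f + f m          ∎

module ℕ∑ where
  open ListSum ℕP.+-0-isCommutativeMonoid public
  open import Data.Nat using (_≤_; z≤n)

  ∑-mono-≤ : ∀ {B : Set} (xs : List B) {f g} → (∀ x → f x ≤ g x) → ∑ xs f ≤ ∑ xs g
  ∑-mono-≤ []       f≤g = z≤n
  ∑-mono-≤ (x ∷ xs) f≤g = ℕP.+-mono-≤ (f≤g x) (∑-mono-≤ xs f≤g)

  ∑-const-1 : ∀ {B : Set} (xs : List B) → ∑ xs (λ _ → 1) ≡ length xs
  ∑-const-1 []       = refl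
  ∑-const-1 (x ∷ xs) = cong suc (∑-const-1 xs)

module ℚ∑ where
  open ListSum ℚP.+-0-isCommutativeMonoid public
  open import Data.Integer using (+_)
  open import Data.Rational using (_/_; _+_; _*_; _≤_)
  open Fraction

  private variable B : Set

  ∑-mono-≤ : ∀ (xs : List B) {f g} → (∀ x → f x ≤ g x) → ∑ xs f ≤ ∑ xs g
  ∑-mono-≤ []       f≤g = ℚP.≤-refl
  ∑-mono-≤ (x ∷ xs) f≤g = ℚP.+-mono-≤ (f≤g x) (∑-mono-≤ xs f≤g)

  ∑-*ʳ : ∀ (xs : List B) f c → ∑ xs f * c ≡ ∑ xs (λ x → f x * c)
  ∑-*ʳ []       f c = ℚP.*-zeroˡ c
  ∑-*ʳ (x ∷ xs) f c = trans (ℚP.*-distribʳ-+ c (f x) (∑ xs f)) (cong (λ s → f x * c + s) (∑-*ʳ xs f c))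

  ∑-/ : ∀ (xs : List B) (h : B → ℕ) d .{{_ : ℕ.NonZero d}} →
        ∑ xs (λ x → (+ h x) / d) ≡ (+ ℕ∑.∑ xs h) / d
  ∑-/ []       h d@(suc _) = sym (ℚP.0/n≡0 d)
  ∑-/ (x ∷ xs) h d@(suc _) = trans (cong (λ s → (+ h x) / d + s) (∑-/ xs h d))
    (/+/≡/ (h x) d (ℕ∑.∑ xs h) d (h x ℕ.+ ℕ∑.∑ xs h) d (cross (h x) (ℕ∑.∑ xs h)))
    where
    cross : ∀ a b → (a ℕ.* d ℕ.+ b ℕ.* d) ℕ.* d ≡ (a ℕ.+ b) ℕ.* (d ℕ.* d)
    cross a b = trans (cong (ℕ._* d) (sym (ℕP.*-distribʳ-+ d a b))) (ℕP.*-assoc (a ℕ.+ b) d d)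

module Exponential where
  open import Data.Nat as ℕ using (zero; _!)
  open import Data.Nat.Properties using (_!≢0)
  open import Data.Integer using (+_)
  open import Data.Rational using (ℚ; _/_; _+_; _-_; _*_; _≤_; 0ℚ; 1ℚ; -_; nonNegative)
  open import Data.Rational.Solver using (module +-*-Solver)
  open +-*-Solver
  open import Data.Sum using (inj₁; inj₂)
  open import Data.List using (upTo)
  open Fraction
  open ℚP.≤-Reasoning

  private
    *-mono-≤-nonNeg : ∀ {a b c d} → 0ℚ ≤ a → 0ℚ ≤ d → a ≤ c → b ≤ d → a * b ≤ c * d
    *-mono-≤-nonNeg {a} {d = d} 0≤a 0≤d a≤c b≤d =
      ℚP.≤-trans (ℚP.*-monoˡ-≤-nonNeg a {{nonNegative 0≤a}} b≤d) (ℚP.*-monoʳ-≤-nonNeg d {{nonNegative 0≤d}} a≤c)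

    p≤q⇒0≤q-p : ∀ {x y} → y ≤ x → 0ℚ ≤ x - y
    p≤q⇒0≤q-p {x} {y} y≤x = begin
      0ℚ    ≡⟨ sym (ℚP.+-inverseʳ y) ⟩
      y - y ≤⟨ ℚP.+-monoˡ-≤ (- y) y≤x ⟩
      x - y ∎

    p≤q+r⇒p-q≤r : ∀ {x y z} → x ≤ y + z → x - y ≤ z
    p≤q+r⇒p-q≤r {x} {y} {z} x≤y+z = begin
      x - y       ≤⟨ ℚP.+-monoˡ-≤ (- y) x≤y+z ⟩
      y + z - y   ≡⟨ solve 2 (λ y z → y :+ z :- y := z) refl y z ⟩
      z           ∎

  pow-nonNeg : ∀ {x} m → 0ℚ ≤ x → 0ℚ ≤ pow x m
  pow-nonNeg zero    0≤x = ℚP.nonNegative⁻¹ 1ℚ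
  pow-nonNeg {x} (suc m) 0≤x = ℚP.nonNegative⁻¹ (x * pow x m)
    {{ℚP.nonNeg*nonNeg⇒nonNeg x {{nonNegative 0≤x}} (pow x m) {{nonNegative (pow-nonNeg m 0≤x)}}}}

  pow-mono-≤ : ∀ {x y} m → 0ℚ ≤ y → y ≤ x → pow y m ≤ pow x m
  pow-mono-≤ zero    0≤y y≤x = ℚP.≤-refl
  pow-mono-≤ (suc m) 0≤y y≤x =
    *-mono-≤-nonNeg 0≤y (pow-nonNeg m (ℚP.≤-trans 0≤y y≤x)) y≤x (pow-mono-≤ m 0≤y y≤x)

  pow-meanValue : ∀ {x y} m → 0ℚ ≤ y → y ≤ x →
                  pow x (suc m) ≤ pow y (suc m) + ((+ suc m) / 1 * (x - y)) * pow x m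
  pow-meanValue {x} {y} zero 0≤y y≤x = ℚP.≤-reflexive
    (solve 2 (λ x y → x :* con 1ℚ := y :* con 1ℚ :+ (con 1ℚ :* (x :- y)) :* con 1ℚ) refl x y)
  pow-meanValue {x} {y} (suc m) 0≤y y≤x = begin
    x * pow x (suc m)
      ≤⟨ ℚP.*-monoˡ-≤-nonNeg x {{nonNegative 0≤x}} (pow-meanValue m 0≤y y≤x) ⟩
    x * (pow y (suc m) + (c * (x - y)) * pow x m)
      ≡⟨ solve 5 (λ x y py px c → x :* (py :+ (c :* (x :- y)) :* px)
                   := (y :* py :+ (x :- y) :* py) :+ (c :* (x :- y)) :* (x :* px))
               refl x y (pow y (suc m)) (pow x m) c ⟩
    (y * pow y (suc m) + (x - y) * pow y (suc m)) + (c * (x - y)) * (x * pow x m)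
      ≤⟨ ℚP.+-monoˡ-≤ ((c * (x - y)) * (x * pow x m)) (ℚP.+-monoʳ-≤ (y * pow y (suc m))
           (ℚP.*-monoˡ-≤-nonNeg (x - y) {{nonNegative (p≤q⇒0≤q-p y≤x)}} (pow-mono-≤ (suc m) 0≤y y≤x))) ⟩
    (y * pow y (suc m) + (x - y) * pow x (suc m)) + (c * (x - y)) * (x * pow x m)
      ≡⟨ solve 5 (λ x y py px1 c → (y :* py :+ (x :- y) :* px1) :+ (c :* (x :- y)) :* px1
                   := y :* py :+ ((c :+ con 1ℚ) :* (x :- y)) :* px1)
               refl x y (pow y (suc m)) (x * pow x m) c ⟩
    y * pow y (suc m) + ((c + 1ℚ) * (x - y)) * (x * pow x m)
      ≡⟨ cong (λ z → y * pow y (suc m) + (z * (x - y)) * (x * pow x m)) (n/1+1≡[1+n]/1 (suc m)) ⟩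
    pow y (suc (suc m)) + ((+ suc (suc m)) / 1 * (x - y)) * pow x (suc m)
      ∎
    where
    c = (+ suc m) / 1
    0≤x = ℚP.≤-trans 0≤y y≤x

  1/! : ℕ → ℚ
  1/! m = ((+ 1) / (m !)) {{m !≢0}}

  1/!-suc : ∀ m → 1/! (suc m) ≡ (+ 1) / suc m * 1/! m
  1/!-suc m = sym (/*/≡/ 1 (suc m) 1 (m !) 1 (suc m !) {{_}} {{m !≢0}} {{suc m !≢0}}
                    (trans (ℕP.*-identityˡ (suc m !)) (sym (ℕP.*-identityˡ (suc m !)))))


  expTerm-meanValue : ∀ {x y} m → 0ℚ ≤ y → y ≤ x →
    pow x (suc m) * 1/! (suc m) ≤ pow y (suc m) * 1/! (suc m) + (x - y) * (pow x m * 1/! m)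
  expTerm-meanValue {x} {y} m 0≤y y≤x = begin
    pow x (suc m) * 1/! (suc m)
      ≤⟨ ℚP.*-monoʳ-≤-nonNeg (1/! (suc m)) {{nonNegative (0≤1/n (suc m !) {{suc m !≢0}})}}
           (pow-meanValue m 0≤y y≤x) ⟩
    (pow y (suc m) + (c * (x - y)) * pow x m) * 1/! (suc m)
      ≡⟨ cong (λ z → (pow y (suc m) + (c * (x - y)) * pow x m) * z) (1/!-suc m) ⟩
    (pow y (suc m) + (c * (x - y)) * pow x m) * (a * 1/! m)
      ≡⟨ solve 7 (λ py c x y px a b → (py :+ (c :* (x :- y)) :* px) :* (a :* b)
                   := py :* (a :* b) :+ (c :* a) :* ((x :- y) :* (px :* b)))
               refl (pow y (suc m)) c x y (pow x m) a (1/! m) ⟩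
    pow y (suc m) * (a * 1/! m) + (c * a) * ((x - y) * (pow x m * 1/! m))
      ≡⟨ cong₂ (λ u v → pow y (suc m) * u + v * ((x - y) * (pow x m * 1/! m))) (sym (1/!-suc m)) ([1+n]/1*1/[1+n]≡1 m) ⟩
    pow y (suc m) * 1/! (suc m) + 1ℚ * ((x - y) * (pow x m * 1/! m))
      ≡⟨ cong (λ z → pow y (suc m) * 1/! (suc m) + z) (ℚP.*-identityˡ _) ⟩
    pow y (suc m) * 1/! (suc m) + (x - y) * (pow x m * 1/! m)
      ∎
    where
    c = (+ suc m) / 1
    a = (+ 1) / suc m

  expPartial-meanValue : ∀ {x y} N → 0ℚ ≤ y → y ≤ x →
    expPartial x (suc N) ≤ expPartial y (suc N) + (x - y) * expPartial x N
  expPartial-meanValue {x} {y} zero 0≤y y≤x =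
    ℚP.≤-reflexive (solve 2 (λ e d → e := e :+ d :* con 0ℚ) refl (expPartial y 1) (x - y))
  expPartial-meanValue {x} {y} (suc N) 0≤y y≤x = begin
    expPartial x (suc N) + tx
      ≤⟨ ℚP.+-mono-≤ (expPartial-meanValue N 0≤y y≤x) (expTerm-meanValue N 0≤y y≤x) ⟩
    (expPartial y (suc N) + (x - y) * expPartial x N) + (ty + (x - y) * sx)
      ≡⟨ solve 5 (λ ey d ex t s → (ey :+ d :* ex) :+ (t :+ d :* s) := (ey :+ t) :+ d :* (ex :+ s))
               refl (expPartial y (suc N)) (x - y) (expPartial x N) ty sx ⟩
    (expPartial y (suc N) + ty) + (x - y) * (expPartial x N + sx)
      ∎
    where
    tx = pow x (suc N) * 1/! (suc N)
    ty = pow y (suc N) * 1/! (suc N)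
    sx = pow x N * 1/! N

  expPartial-zero : ∀ N → expPartial 0ℚ (suc N) ≡ 1ℚ
  expPartial-zero zero    = refl
  expPartial-zero (suc N) = trans (cong (λ e → e + (0ℚ * pow 0ℚ N) * 1/! (suc N)) (expPartial-zero N))
    (solve 2 (λ p c → con 1ℚ :+ (con 0ℚ :* p) :* c := con 1ℚ) refl (pow 0ℚ N) (1/! (suc N)))

  harmonic : ℕ → ℚ
  harmonic n = ℚ∑.∑ (upTo n) (λ k → (+ 1) / suc k)

  harmonic-suc : ∀ n → harmonic (suc n) ≡ harmonic n + (+ 1) / suc n
  harmonic-suc n = ℚ∑.∑-upTo-suc n (λ k → (+ 1) / suc k)

  1≤harmonic-suc : ∀ n → 1ℚ ≤ harmonic (suc n)
  1≤harmonic-suc zero    = ℚP.≤-refl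
  1≤harmonic-suc (suc n) = begin
    1ℚ                                     ≡⟨ sym (ℚP.+-identityʳ 1ℚ) ⟩
    1ℚ + 0ℚ                                ≤⟨ ℚP.+-mono-≤ (1≤harmonic-suc n) (0≤1/n (suc (suc n))) ⟩
    harmonic (suc n) + (+ 1) / suc (suc n) ≡⟨ sym (harmonic-suc (suc n)) ⟩
    harmonic (suc (suc n))                 ∎

  expPartial-≤-harmonic : ∀ N p {x} → 0ℚ ≤ x → x ≤ harmonic (suc p) - 1ℚ →
                          expPartial x N ≤ (+ suc p) / 1
  expPartial-≤-harmonic zero    p        _   _   = /≤/ 0 1 (suc p) 1 ℕ.z≤n
  expPartial-≤-harmonic (suc N) zero {x} 0≤x x≤0 with ℚP.≤-antisym x≤0 0≤x
  ... | refl = ℚP.≤-reflexive (expPartial-zero N)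
  expPartial-≤-harmonic (suc N) (suc p) {x} 0≤x x≤h with ℚP.≤-total x (harmonic (suc p) - 1ℚ)
  ... | inj₁ x≤y = ℚP.≤-trans (expPartial-≤-harmonic (suc N) p 0≤x x≤y)
                              (/≤/ (suc p) 1 (suc (suc p)) 1 (ℕP.*-monoˡ-≤ 1 (ℕP.n≤1+n (suc p))))
  ... | inj₂ y≤x = begin
    expPartial x (suc N)
      ≤⟨ expPartial-meanValue N 0≤y y≤x ⟩
    expPartial y (suc N) + (x - y) * expPartial x N
      ≤⟨ ℚP.+-mono-≤ (expPartial-≤-harmonic (suc N) p 0≤y ℚP.≤-refl)
           (*-mono-≤-nonNeg (p≤q⇒0≤q-p y≤x) (/≤/ 0 1 (suc (suc p)) 1 ℕ.z≤n) x-y≤r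
              (expPartial-≤-harmonic N (suc p) 0≤x x≤h)) ⟩
    (+ suc p) / 1 + r * ((+ suc (suc p)) / 1)
      ≡⟨ cong (λ z → (+ suc p) / 1 + z) (trans (ℚP.*-comm r _) ([1+n]/1*1/[1+n]≡1 (suc p))) ⟩
    (+ suc p) / 1 + 1ℚ
      ≡⟨ n/1+1≡[1+n]/1 (suc p) ⟩
    (+ suc (suc p)) / 1
      ∎
    where
    y = harmonic (suc p) - 1ℚ
    r = (+ 1) / suc (suc p)
    0≤y : 0ℚ ≤ y
    0≤y = p≤q⇒0≤q-p (1≤harmonic-suc p)
    x-y≤r : x - y ≤ r
    x-y≤r = p≤q+r⇒p-q≤r (subst (x ≤_) h-split x≤h)
      where
      h-split : harmonic (suc (suc p)) - 1ℚ ≡ y + r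
      h-split = trans (cong (_- 1ℚ) (harmonic-suc (suc p)))
        (solve 2 (λ h r → (h :+ r) :- con 1ℚ := (h :- con 1ℚ) :+ r) refl (harmonic (suc p)) r)

  ≤ln-of-≤harmonic-1 : ∀ p {x} → x ≤ harmonic (suc p) - 1ℚ → x ≤ln suc p
  ≤ln-of-≤harmonic-1 p {x} x≤h with ℚP.≤-total x 0ℚ
  ... | inj₁ x≤0 = inj₁ x≤0
  ... | inj₂ 0≤x = inj₂ (λ N → expPartial-≤-harmonic N p 0≤x x≤h)

module Periods where
  open import Data.Nat using (zero; _+_; _∸_; _≤_; _<_; z≤n; s≤s)
  open import Data.Bool using (Bool; true; false; _∧_)
  open import Data.List using ([]; upTo; foldr)
  open import Data.List.Membership.Propositional using (_∈_)
  open import Data.List.Membership.Propositional.Properties using (∈-upTo⁺; ∈-upTo⁻)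
  open import Data.List.Relation.Unary.Any using (here; there)
  open import Data.Maybe using (Maybe)
  import Data.Maybe.Properties as MaybeP
  import Data.Fin.Properties as FinP
  open import Data.Product using (_×_; _,_; proj₁; proj₂)
  open import Data.Sum using (_⊎_; inj₁; inj₂)
  open import Data.Empty using (⊥-elim)
  open import Relation.Nullary.Decidable using (⌊_⌋; yes; no)

  private variable k : ℕ

  HasPeriod : List (Fin k) → ℕ → Set
  HasPeriod u p = ∀ s → s + p < length u → at u s ≡ at u (s + p)

  private
    ∧-≡-true : ∀ {a b} → a ∧ b ≡ true → a ≡ true × b ≡ true
    ∧-≡-true {true} {true} _ = refl , refl

    foldr-∧-sound : ∀ (h : ℕ → Bool) (l : List ℕ) →
      foldr (λ t b → b ∧ h t) true l ≡ true → ∀ {s} → s ∈ l → h s ≡ true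
    foldr-∧-sound h (x ∷ l) eq (here refl) = proj₂ (∧-≡-true eq)
    foldr-∧-sound h (x ∷ l) eq (there s∈l) = foldr-∧-sound h l (proj₁ (∧-≡-true eq)) s∈l

    foldr-∧-complete : ∀ (h : ℕ → Bool) (l : List ℕ) →
      (∀ {s} → s ∈ l → h s ≡ true) → foldr (λ t b → b ∧ h t) true l ≡ true
    foldr-∧-complete h []      _   = refl
    foldr-∧-complete h (x ∷ l) all rewrite foldr-∧-complete h l (λ s∈l → all (there s∈l)) | all (here refl) = refl

    ≡-dec-sound : ∀ (x y : Maybe (Fin k)) → ⌊ MaybeP.≡-dec FinP._≟_ x y ⌋ ≡ true → x ≡ y
    ≡-dec-sound x y eq with MaybeP.≡-dec FinP._≟_ x y
    ... | yes x≡y = x≡y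

    ≡-dec-complete : ∀ (x y : Maybe (Fin k)) → x ≡ y → ⌊ MaybeP.≡-dec FinP._≟_ x y ⌋ ≡ true
    ≡-dec-complete x y x≡y with MaybeP.≡-dec FinP._≟_ x y
    ... | yes _   = refl
    ... | no x≢y = ⊥-elim (x≢y x≡y)

  isPeriod-sound : ∀ (u : List (Fin k)) p → isPeriod u p ≡ true → HasPeriod u p
  isPeriod-sound u p eq s s+p<|u| =
    ≡-dec-sound _ _ (foldr-∧-sound _ (upTo (length u ∸ p)) eq (∈-upTo⁺ (ℕP.m+n≤o⇒m≤o∸n (suc s) s+p<|u|)))

  isPeriod-complete : ∀ (u : List (Fin k)) p → HasPeriod u p → isPeriod u p ≡ true
  isPeriod-complete u p per = foldr-∧-complete _ (upTo (length u ∸ p))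
    (λ {s} s∈ → let s<|u|∸p = ∈-upTo⁻ s∈ in
      ≡-dec-complete _ _ (per s (ℕP.m≤o∸n⇒m+n≤o (suc s) (s<n∸p⇒p≤n p (length u) s<|u|∸p) s<|u|∸p)))
    where
    s<n∸p⇒p≤n : ∀ p n {s} → s < n ∸ p → p ≤ n
    s<n∸p⇒p≤n zero    n       _         = z≤n
    s<n∸p⇒p≤n (suc p) (suc n) s<n∸p = s≤s (s<n∸p⇒p≤n p n s<n∸p)

  module _ (u : List (Fin k)) where
    periodSearch-≤ : ∀ f q m → isPeriod u (suc m) ≡ true → q ≤ m → periodSearch u q f ≤ m
    periodSearch-≤ zero    q m _   q≤m = q≤m
    periodSearch-≤ (suc f) q m per q≤m with isPeriod u (suc q) in eq
    ... | true  = q≤m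
    ... | false with ℕP.m≤n⇒m<n∨m≡n q≤m
    ...   | inj₁ q<m  = periodSearch-≤ f (suc q) m per q<m
    ...   | inj₂ refl with trans (sym eq) per
    ...     | ()

    periodSearch-found : ∀ f q → isPeriod u (suc (periodSearch u q f)) ≡ true ⊎ periodSearch u q f ≡ q + f
    periodSearch-found zero    q = inj₂ (sym (ℕP.+-identityʳ q))
    periodSearch-found (suc f) q with isPeriod u (suc q) in eq
    ... | true  = inj₁ eq
    ... | false with periodSearch-found f (suc q)
    ...   | inj₁ found = inj₁ found
    ...   | inj₂ e     = inj₂ (trans e (sym (ℕP.+-suc q f)))

    period-isPeriod : isPeriod u (period u) ≡ true
    period-isPeriod with periodSearch-found (length u) 0
    ... | inj₁ found = found
    ... | inj₂ e rewrite e = isPeriod-complete u (suc (length u)) vacuous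
      where
      -- The search ran out, so the period is |u| + 1, which is vacuously a period.
      vacuous : HasPeriod u (suc (length u))
      vacuous s lt = ⊥-elim (ℕP.<-irrefl refl (ℕP.<-≤-trans lt |u|≤s+|u|+1))
        where |u|≤s+|u|+1 = ℕP.≤-trans (ℕP.n≤1+n (length u)) (ℕP.m≤n+m (suc (length u)) s)

    period-minimal : ∀ m → isPeriod u (suc m) ≡ true → period u ≤ suc m
    period-minimal m per = s≤s (periodSearch-≤ (length u) 0 m per z≤n)

module Repetitions {k} (W : List (Fin k)) where
  open import Data.Nat using (zero; _+_; _∸_; _⊓_; _≤_; _<_; _≤ᵇ_; _<ᵇ_; _≡ᵇ_; s≤s)
  open import Data.Bool using (Bool; true; false; _∧_; if_then_else_; T)
  import Data.Bool.Properties as BoolP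
  open import Data.List using ([]; take; drop)
  import Data.List.Properties as ListP
  open import Data.Product using (_×_; _,_)
  open import Data.Unit using (⊤)
  open import Data.Empty using (⊥; ⊥-elim)
  open import Function using (Equivalence)
  open import Relation.Nullary.Decidable using (yes; no)
  open import Relation.Binary.Definitions using (tri<; tri≈; tri>)
  open Periods
  open ≡-Reasoning

  n : ℕ
  n = length W

  π : ℕ → ℕ → ℕ
  π i j = period (factor W i j)

  len : ℕ → ℕ → ℕ
  len i j = length (factor W i j)

  len-factor : ∀ i j → suc j ≤ n → len i j ≡ suc j ∸ i
  len-factor i j j<n = begin
    length (take (suc j ∸ i) (drop i W))  ≡⟨ ListP.length-take (suc j ∸ i) (drop i W) ⟩
    (suc j ∸ i) ⊓ length (drop i W)       ≡⟨ cong ((suc j ∸ i) ⊓_) (ListP.length-drop i W) ⟩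
    (suc j ∸ i) ⊓ (n ∸ i)                 ≡⟨ ℕP.m≤n⇒m⊓n≡m (ℕP.∸-monoˡ-≤ i j<n) ⟩
    suc j ∸ i                             ∎

  private
    at-take : ∀ (l : List (Fin k)) m s → s < m → at (take m l) s ≡ at l s
    at-take (x ∷ l) (suc m) zero    _         = refl
    at-take (x ∷ l) (suc m) (suc s) (s≤s s<m) = at-take l m s s<m
    at-take []      (suc m) s       _         = refl

    at-drop : ∀ (l : List (Fin k)) i s → at (drop i l) s ≡ at l (i + s)
    at-drop l       zero    s = refl
    at-drop []      (suc i) s = refl
    at-drop (x ∷ l) (suc i) s = at-drop l i s

  at-factor : ∀ i j s → s < suc j ∸ i → at (factor W i j) s ≡ at W (i + s)
  at-factor i j s s<len = trans (at-take (drop i W) (suc j ∸ i) s s<len) (at-drop W i s)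

  PeriodicOn : ℕ → ℕ → ℕ → Set
  PeriodicOn i j Q = ∀ s → i ≤ s → s + Q ≤ j → at W s ≡ at W (s + Q)

  private
    i+s+Q≡s+Q+i : ∀ i s Q → i + s + Q ≡ s + Q + i
    i+s+Q≡s+Q+i i s Q = trans (ℕP.+-assoc i s Q) (ℕP.+-comm i (s + Q))

    i+s+Q≤j⇒s+Q<1+j∸i : ∀ i j s Q → i + s + Q ≤ j → s + Q < suc j ∸ i
    i+s+Q≤j⇒s+Q<1+j∸i i j s Q le = ℕP.m+n≤o⇒m≤o∸n (suc (s + Q)) (s≤s (subst (_≤ j) (i+s+Q≡s+Q+i i s Q) le))

    s+Q<1+j∸i⇒i+s+Q≤j : ∀ i j s Q → i ≤ suc j → s + Q < suc j ∸ i → i + s + Q ≤ j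
    s+Q<1+j∸i⇒i+s+Q≤j i j s Q i≤1+j lt =
      ℕP.≤-pred (subst (_≤ suc j) (cong suc (sym (i+s+Q≡s+Q+i i s Q))) (ℕP.m≤o∸n⇒m+n≤o (suc (s + Q)) i≤1+j lt))

  HasPeriod⇒PeriodicOn : ∀ i j Q → suc j ≤ n → HasPeriod (factor W i j) Q → PeriodicOn i j Q
  HasPeriod⇒PeriodicOn i j Q j<n per s i≤s s+Q≤j =
    subst (λ s → at W s ≡ at W (s + Q)) (ℕP.m+[n∸m]≡n i≤s) shifted
    where
    s′ = s ∸ i
    bound : s′ + Q < suc j ∸ i
    bound = i+s+Q≤j⇒s+Q<1+j∸i i j s′ Q (subst (λ s → s + Q ≤ j) (sym (ℕP.m+[n∸m]≡n i≤s)) s+Q≤j)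
    shifted : at W (i + s′) ≡ at W (i + s′ + Q)
    shifted = begin
      at W (i + s′)               ≡⟨ sym (at-factor i j s′ (ℕP.≤-<-trans (ℕP.m≤m+n s′ Q) bound)) ⟩
      at (factor W i j) s′        ≡⟨ per s′ (subst (s′ + Q <_) (sym (len-factor i j j<n)) bound) ⟩
      at (factor W i j) (s′ + Q)  ≡⟨ at-factor i j (s′ + Q) bound ⟩
      at W (i + (s′ + Q))         ≡⟨ cong (at W) (sym (ℕP.+-assoc i s′ Q)) ⟩
      at W (i + s′ + Q)           ∎

  PeriodicOn⇒HasPeriod : ∀ i j Q → i ≤ j → suc j ≤ n → PeriodicOn i j Q → HasPeriod (factor W i j) Q
  PeriodicOn⇒HasPeriod i j Q i≤j j<n per s s+Q<len = begin
    at (factor W i j) s        ≡⟨ at-factor i j s (ℕP.≤-<-trans (ℕP.m≤m+n s Q) bound) ⟩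
    at W (i + s)               ≡⟨ per (i + s) (ℕP.m≤m+n i s) (s+Q<1+j∸i⇒i+s+Q≤j i j s Q (ℕP.m≤n⇒m≤1+n i≤j) bound) ⟩
    at W (i + s + Q)           ≡⟨ cong (at W) (ℕP.+-assoc i s Q) ⟩
    at W (i + (s + Q))         ≡⟨ sym (at-factor i j (s + Q) bound) ⟩
    at (factor W i j) (s + Q)  ∎
    where
    bound : s + Q < suc j ∸ i
    bound = subst (s + Q <_) (len-factor i j j<n) s+Q<len

  π-periodicOn : ∀ i j → suc j ≤ n → PeriodicOn i j (π i j)
  π-periodicOn i j j<n =
    HasPeriod⇒PeriodicOn i j (π i j) j<n (isPeriod-sound (factor W i j) (π i j) (period-isPeriod (factor W i j)))

  π-minimal : ∀ i j Q .{{_ : ℕ.NonZero Q}} → i ≤ j → suc j ≤ n → PeriodicOn i j Q → π i j ≤ Q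
  π-minimal i j (suc Q) i≤j j<n per =
    period-minimal (factor W i j) Q (isPeriod-complete (factor W i j) (suc Q) (PeriodicOn⇒HasPeriod i j (suc Q) i≤j j<n per))

  LeftMaximal : ℕ → ℕ → Set
  LeftMaximal zero    j = ⊤
  LeftMaximal (suc i) j = π (suc i) j < π i j

  record IsMaxRep (i j : ℕ) : Set where
    field
      i≤j         : i ≤ j
      j<n         : suc j ≤ n
      leftMaximal  : LeftMaximal i j
      rightMaximal : suc j < n → π i j < π i (suc j)
      π<len        : π i j < len i j

  private
    T-∧⁵ : ∀ {a b c d e} → T (a ∧ b ∧ c ∧ d ∧ e) → T a × T b × T c × T d × T e
    T-∧⁵ {true} {true} {true} {true} {true} _ = _ , _ , _ , _ , _

    leftMaximalᵇ : ℕ → ℕ → Bool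
    leftMaximalᵇ zero    j = true
    leftMaximalᵇ (suc i) j = π (suc i) j <ᵇ π i j

    rightMaximalᵇ : ℕ → ℕ → Bool
    rightMaximalᵇ i j = if suc j ≡ᵇ n then true else (π i j <ᵇ π i (suc j))

    isMR-unfold : ∀ i j → isMR W (i , j) ≡
      ((i ≤ᵇ j) ∧ (suc j ≤ᵇ n) ∧ leftMaximalᵇ i j ∧ rightMaximalᵇ i j ∧ (π i j <ᵇ len i j))
    isMR-unfold zero    j = refl
    isMR-unfold (suc i) j = refl

    T-leftMaximalᵇ : ∀ i j → T (leftMaximalᵇ i j) → LeftMaximal i j
    T-leftMaximalᵇ zero    j _ = _
    T-leftMaximalᵇ (suc i) j t = ℕP.<ᵇ⇒< _ _ t

    T-rightMaximalᵇ : ∀ i j → T (if suc j ≡ᵇ n then true else (π i j <ᵇ π i (suc j))) →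
                      suc j < n → π i j < π i (suc j)
    T-rightMaximalᵇ i j t j+1<n with suc j ≡ᵇ n in e
    ... | true  = ⊥-elim (ℕP.<-irrefl (ℕP.≡ᵇ⇒≡ (suc j) n (subst T (sym e) _)) j+1<n)
    ... | false = ℕP.<ᵇ⇒< _ _ t

  isMR⇒IsMaxRep : ∀ i j → isMR W (i , j) ≡ true → IsMaxRep i j
  isMR⇒IsMaxRep i j eq with T-∧⁵ (subst T (isMR-unfold i j) (Equivalence.from BoolP.T-≡ eq))
  ... | i≤ᵇj , j<ᵇn , left , right , π<ᵇlen = record
    { i≤j          = ℕP.≤ᵇ⇒≤ i j i≤ᵇj
    ; j<n          = ℕP.≤ᵇ⇒≤ (suc j) n j<ᵇn
    ; leftMaximal  = T-leftMaximalᵇ i j left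
    ; rightMaximal = T-rightMaximalᵇ i j right
    ; π<len        = ℕP.<ᵇ⇒< _ _ π<ᵇlen
    }

  open IsMaxRep

  private
    left-extension-contradiction : ∀ {i j i′ j′ t} → IsMaxRep i j → IsMaxRep (suc i′) j′ →
      π (suc i′) j′ ≡ π i j → i ≤ i′ → i ≤ t → t + π i j ≤ j → suc i′ ≤ t → t + π i j ≤ j′ → ⊥
    left-extension-contradiction {i} {j} {i′} {j′} {t} r r′ same i≤i′ i≤t t+Q≤j i′<t t+Q≤j′ =
      ℕP.<-irrefl refl (ℕP.<-≤-trans (subst (_< π i′ j′) same (leftMaximal r′)) π[i′,j′]≤Q)
      where
      Q = π i j
      periodic′ : PeriodicOn (suc i′) j′ Q
      periodic′ = subst (PeriodicOn (suc i′) j′) same (π-periodicOn (suc i′) j′ (j<n r′))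
      extended : PeriodicOn i′ j′ Q
      extended s i′≤s s+Q≤j′ with s ℕP.≤? t
      ... | yes s≤t = π-periodicOn i j (j<n r) s (ℕP.≤-trans i≤i′ i′≤s) (ℕP.≤-trans (ℕP.+-monoˡ-≤ Q s≤t) t+Q≤j)
      ... | no  s≰t = periodic′ s (ℕP.≤-trans i′<t (ℕP.<⇒≤ (ℕP.≰⇒> s≰t))) s+Q≤j′
      π[i′,j′]≤Q : π i′ j′ ≤ Q
      π[i′,j′]≤Q = π-minimal i′ j′ Q (ℕP.≤-trans (ℕP.n≤1+n i′) (i≤j r′)) (j<n r′) extended

    right-extension-contradiction : ∀ {i j j′} → IsMaxRep i j → IsMaxRep i j′ →
      π i j′ ≡ π i j → j < j′ → ⊥
    right-extension-contradiction {i} {j} {j′} r r′ same j<j′ =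
      ℕP.<-irrefl refl (ℕP.<-≤-trans (rightMaximal r j+1<n) π[i,j+1]≤Q)
      where
      Q = π i j
      j+1<n : suc j < n
      j+1<n = ℕP.<-≤-trans (s≤s j<j′) (j<n r′)
      periodic : PeriodicOn i (suc j) Q
      periodic s i≤s s+Q≤j+1 =
        subst (PeriodicOn i j′) same (π-periodicOn i j′ (j<n r′)) s i≤s (ℕP.≤-trans s+Q≤j+1 j<j′)
      π[i,j+1]≤Q : π i (suc j) ≤ Q
      π[i,j+1]≤Q = π-minimal i (suc j) Q (ℕP.m≤n⇒m≤1+n (i≤j r)) j+1<n periodic

  maxRep-unique : ∀ {i j i′ j′ t} → IsMaxRep i j → IsMaxRep i′ j′ → π i′ j′ ≡ π i j →
    i ≤ t → t + π i j ≤ j → i′ ≤ t → t + π i j ≤ j′ → i ≡ i′ × j ≡ j′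
  maxRep-unique {i} {j} {i′} {j′} r r′ same i≤t t+Q≤j i′≤t t+Q≤j′ with ℕP.<-cmp i i′
  maxRep-unique {i′ = suc i′} r r′ same i≤t t+Q≤j i′≤t t+Q≤j′ | tri< (s≤s i≤i′) _ _ =
    ⊥-elim (left-extension-contradiction r r′ same i≤i′ i≤t t+Q≤j i′≤t t+Q≤j′)
  maxRep-unique {suc i} {j} {i′} {j′} {t} r r′ same i≤t t+Q≤j i′≤t t+Q≤j′ | tri> _ _ (s≤s i′≤i) =
    ⊥-elim (left-extension-contradiction r′ r (sym same) i′≤i i′≤t
              (subst (λ Q → t + Q ≤ j′) (sym same) t+Q≤j′) i≤t (subst (λ Q → t + Q ≤ j) (sym same) t+Q≤j))
  ... | tri≈ _ refl _ with ℕP.<-cmp j j′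
  ...   | tri< j<j′ _ _ = ⊥-elim (right-extension-contradiction r r′ same j<j′)
  ...   | tri≈ _ refl _ = refl , refl
  ...   | tri> _ _ j′<j = ⊥-elim (right-extension-contradiction r′ r (sym same) j′<j)

module Counting where
  open import Data.Nat using (zero; _+_; _∸_; _⊓_; _≤_; _<_; _≤ᵇ_; _<ᵇ_; z≤n; s≤s)
  open import Data.Bool using (Bool; true; false; _∧_; if_then_else_; T)
  import Data.Bool.Properties as BoolP
  open import Data.List using (upTo)
  open import Data.List.Membership.Propositional using (_∈_)
  open import Data.List.Membership.Propositional.Properties using (∈-upTo⁻)
  open import Data.Product using (_×_; _,_; ∃-syntax)
  open import Data.Sum using (inj₁; inj₂)
  open import Data.Empty using (⊥-elim)
  open ℕ∑
  open ≡-Reasoning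

  private variable B : Set

  when : Bool → ℕ → ℕ
  when b x = if b then x else 0

  ∑-when : ∀ (xs : List B) b f → ∑ xs (λ x → when b (f x)) ≡ when b (∑ xs f)
  ∑-when xs true  f = refl
  ∑-when xs false f = ∑-zero xs (λ _ → refl)

  when-cong : ∀ b {x y} → (b ≡ true → x ≡ y) → when b x ≡ when b y
  when-cong true  x≡y = x≡y refl
  when-cong false _   = refl

  when-≤1 : ∀ b {x} → x ≤ 1 → when b x ≤ 1
  when-≤1 true  x≤1 = x≤1
  when-≤1 false _   = z≤n

  when-pos : ∀ b {x} → 1 ≤ when b x → T b × 1 ≤ x
  when-pos true 1≤x = _ , 1≤x

  inRange : ℕ → ℕ → ℕ → ℕ
  inRange a b t = when ((a ≤ᵇ t) ∧ (t <ᵇ b)) 1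

  inRange-≤1 : ∀ a b t → inRange a b t ≤ 1
  inRange-≤1 a b t = when-≤1 ((a ≤ᵇ t) ∧ (t <ᵇ b)) ℕP.≤-refl

  inRange-pos : ∀ a b t → 1 ≤ inRange a b t → a ≤ t × t < b
  inRange-pos a b t 1≤ind with a ≤ᵇ t in a≤ᵇt | t <ᵇ b in t<ᵇb
  ... | true | true = ℕP.≤ᵇ⇒≤ a t (subst T (sym a≤ᵇt) _) , ℕP.<ᵇ⇒< t b (subst T (sym t<ᵇb) _)

  private
    inRange-i+s+Q≤j⇒s+Q<1+j∸i : ∀ {a b t} → a ≤ t → t < b → inRange a b t ≡ 1
    inRange-i+s+Q≤j⇒s+Q<1+j∸i {a} {b} {t} a≤t t<b with a ≤ᵇ t in a≤ᵇt | t <ᵇ b in t<ᵇb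
    ... | true  | true  = refl
    ... | false | _     = ⊥-elim (subst T a≤ᵇt (ℕP.≤⇒≤ᵇ a≤t))
    ... | true  | false = ⊥-elim (subst T t<ᵇb (ℕP.<⇒<ᵇ t<b))

    inRange-below : ∀ {a b t} → t < a → inRange a b t ≡ 0
    inRange-below {a} {b} {t} t<a with a ≤ᵇ t in a≤ᵇt
    ... | false = refl
    ... | true  = ⊥-elim (ℕP.<⇒≱ t<a (ℕP.≤ᵇ⇒≤ a t (subst T (sym a≤ᵇt) _)))

    inRange-above : ∀ {a b t} → b ≤ t → inRange a b t ≡ 0
    inRange-above {a} {b} {t} b≤t with t <ᵇ b in t<ᵇb
    ... | false = cong (λ c → when c 1) (BoolP.∧-zeroʳ (a ≤ᵇ t))
    ... | true  = ⊥-elim (ℕP.<⇒≱ (ℕP.<ᵇ⇒< t b (subst T (sym t<ᵇb) _)) b≤t)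

  ∑-inRange : ∀ a b m → ∑ (upTo m) (inRange a b) ≡ (b ⊓ m) ∸ a
  ∑-inRange a b zero    = trans (sym (ℕP.0∸n≡0 a)) (cong (_∸ a) (sym (ℕP.⊓-zeroʳ b)))
  ∑-inRange a b (suc m) = trans (∑-upTo-suc m (inRange a b)) (trans (cong (_+ inRange a b m) (∑-inRange a b m)) step)
    where
    step : (b ⊓ m) ∸ a + inRange a b m ≡ (b ⊓ suc m) ∸ a
    step with ℕP.<-≤-connex m b
    ... | inj₂ b≤m rewrite inRange-above {a} b≤m | ℕP.m≤n⇒m⊓n≡m b≤m | ℕP.m≤n⇒m⊓n≡m (ℕP.m≤n⇒m≤1+n b≤m) =
      ℕP.+-identityʳ _
    ... | inj₁ m<b rewrite ℕP.m≥n⇒m⊓n≡n (ℕP.<⇒≤ m<b) | ℕP.m≥n⇒m⊓n≡n m<b with ℕP.≤-<-connex a m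
    ...   | inj₁ a≤m rewrite inRange-i+s+Q≤j⇒s+Q<1+j∸i a≤m m<b = trans (ℕP.+-comm (m ∸ a) 1) (sym (ℕP.+-∸-assoc 1 a≤m))
    ...   | inj₂ m<a rewrite inRange-below {b = b} m<a | ℕP.m≤n⇒m∸n≡0 (ℕP.<⇒≤ m<a) | ℕP.m≤n⇒m∸n≡0 m<a = refl

  ∑-pos⇒∃ : ∀ (xs : List B) f → 1 ≤ ∑ xs f → ∃[ x ] 1 ≤ f x
  ∑-pos⇒∃ (x ∷ xs) f 1≤∑ with f x in fx
  ... | suc _ = x , subst (1 ≤_) (sym fx) (s≤s z≤n)
  ... | zero  = ∑-pos⇒∃ xs f 1≤∑

  ∑-upTo-≤1 : ∀ m f → (∀ x → f x ≤ 1) → (∀ {x y} → 1 ≤ f x → 1 ≤ f y → x ≡ y) → ∑ (upTo m) f ≤ 1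
  ∑-upTo-≤1 zero    f f≤1 unique = z≤n
  ∑-upTo-≤1 (suc m) f f≤1 unique rewrite ∑-upTo-suc m f with f m in fm
  ... | zero  = subst (_≤ 1) (sym (ℕP.+-identityʳ _)) (∑-upTo-≤1 m f f≤1 unique)
  ... | suc r = subst (λ s → s + suc r ≤ 1) (sym (∑-zero (upTo m) vanishes)) (subst (_≤ 1) fm (f≤1 m))
    where
    vanishes : ∀ {x} → x ∈ upTo m → f x ≡ 0
    vanishes {x} x∈ with f x in fx
    ... | zero  = refl
    ... | suc _ = ⊥-elim (ℕP.<-irrefl x≡m (∈-upTo⁻ x∈))
      where
      x≡m : x ≡ m
      x≡m = unique (subst (1 ≤_) (sym fx) (s≤s z≤n)) (subst (1 ≤_) (sym fm) (s≤s z≤n))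

module RepetitionSum {k} (W : List (Fin k)) (P : ℕ) where
  open import Data.Nat using (zero; _+_; _∸_; _⊓_; _≤_; _<_; _≤ᵇ_; _≡ᵇ_; z≤n; s≤s)
  open import Data.Bool using (Bool; true; false; if_then_else_; T)
  import Data.Bool as Bool
  import Data.Bool.Properties as BoolP
  open import Data.List using (upTo; foldr; filter; map; concatMap)
  import Data.List.Properties as ListP
  open import Data.Integer using (ℤ; +_)
  open import Data.Rational as ℚ using (ℚ; _/_; 0ℚ; 1ℚ)
  open import Data.Product using (_×_; _,_; proj₁; proj₂)
  open import Data.Empty using (⊥-elim)
  open import Function using (Equivalence)
  open import Relation.Nullary using (contradiction)
  open import Relation.Binary.Definitions using (tri<; tri≈; tri>)
  open Fraction
  open Repetitions W
  open IsMaxRep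
  open Counting

  private
    ≡true : ∀ {b} → T b → b ≡ true
    ≡true = Equivalence.to BoolP.T-≡

    ≤ᵇ-false : ∀ {a b} → b < a → (a ≤ᵇ b) ≡ false
    ≤ᵇ-false {a} {b} b<a with a ≤ᵇ b in a≤ᵇb
    ... | false = refl
    ... | true  = ⊥-elim (ℕP.<⇒≱ b<a (ℕP.≤ᵇ⇒≤ a b (subst T (sym a≤ᵇb) _)))

    ≡ᵇ-false : ∀ {a b} → a ≢ b → (a ≡ᵇ b) ≡ false
    ≡ᵇ-false {a} {b} a≢b with a ≡ᵇ b in a≡ᵇb
    ... | false = refl
    ... | true  = ⊥-elim (a≢b (ℕP.≡ᵇ⇒≡ a b (subst T (sym a≡ᵇb) _)))

  ∑-upTo-when≡ᵇ : ∀ m X P → ℚ∑.∑ (upTo P) (λ k → (+ when (m ≡ᵇ k) X) / suc k) ≡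
                             (if suc m ≤ᵇ P then (+ X) / suc m else 0ℚ)
  ∑-upTo-when≡ᵇ m X zero    = refl
  ∑-upTo-when≡ᵇ m X (suc P) rewrite ℚ∑.∑-upTo-suc P (λ k → (+ when (m ≡ᵇ k) X) / suc k) | ∑-upTo-when≡ᵇ m X P
    with ℕP.<-cmp m P
  ... | tri< m<P m≢P _ rewrite ≡true (ℕP.≤⇒≤ᵇ m<P) | ≡ᵇ-false m≢P | ≡true (ℕP.≤⇒≤ᵇ (ℕP.m<n⇒m<1+n m<P)) =
    trans (cong (λ z → (+ X) / suc m ℚ.+ z) (ℚP.0/n≡0 (suc P))) (ℚP.+-identityʳ _)
  ... | tri≈ _ refl _ rewrite ≤ᵇ-false (ℕP.n<1+n m) | ≡true (ℕP.≡⇒≡ᵇ m m refl) | ≡true (ℕP.≤⇒≤ᵇ (ℕP.n<1+n m)) =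
    ℚP.+-identityˡ _
  ... | tri> _ m≢P P<m rewrite ≤ᵇ-false (ℕP.m<n⇒m<1+n P<m) | ≡ᵇ-false m≢P | ≤ᵇ-false (s≤s P<m) =
    trans (cong (0ℚ ℚ.+_) (ℚP.0/n≡0 (suc P))) (ℚP.+-identityˡ 0ℚ)

  if-then-0≡∑-when : ∀ b {v} (X : ℕ → ℕ) → (b ≡ true → v ≡ ℚ∑.∑ (upTo P) (λ k → (+ X k) / suc k)) →
                     (if b then v else 0ℚ) ≡ ℚ∑.∑ (upTo P) (λ k → (+ when b (X k)) / suc k)
  if-then-0≡∑-when true  X v≡∑ = v≡∑ refl
  if-then-0≡∑-when false X _   = sym (ℚ∑.∑-zero (upTo P) (λ {k} _ → ℚP.0/n≡0 (suc k)))

  -- π i j is a successor by definition, so π i j ≡ᵇ suc k and π i j ≤ᵇ P are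
  -- literally ℕ.pred (π i j) ≡ᵇ k and suc (ℕ.pred (π i j)) ≤ᵇ P.
  exponentTerm-as-∑ : ∀ {i j} → IsMaxRep i j →
    (if π i j ≤ᵇ P then exponent (factor W i j) ℚ.- 1ℚ else 0ℚ) ≡
    ℚ∑.∑ (upTo P) (λ k → (+ when (π i j ≡ᵇ suc k) (len i j ∸ π i j)) / suc k)
  exponentTerm-as-∑ {i} {j} r =
    trans (cong (λ v → if π i j ≤ᵇ P then v else 0ℚ) (sym ([L∸q]/q≡L/q-1 (len i j) (π i j) (ℕP.<⇒≤ (π<len r)))))
          (sym (∑-upTo-when≡ᵇ (ℕ.pred (π i j)) (len i j ∸ π i j) P))

  -- covers i j k t = 1 iff (i , j) is a maximal repetition of period k + 1
  -- containing both t and t + k + 1.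
  covers : ℕ → ℕ → ℕ → ℕ → ℕ
  covers i j k t = when (isMR W (i , j)) (when (π i j ≡ᵇ suc k) (inRange i (suc j ∸ π i j) t))

  private
    π≤1+j : ∀ {i j} → IsMaxRep i j → π i j ≤ suc j
    π≤1+j {i} {j} r = ℕP.≤-trans (ℕP.<⇒≤ (π<len r))
      (ℕP.≤-trans (ℕP.≤-reflexive (len-factor i j (j<n r))) (ℕP.m∸n≤m (suc j) i))

  window-size : ∀ {i j} → IsMaxRep i j → ((suc j ∸ π i j) ⊓ n) ∸ i ≡ len i j ∸ π i j
  window-size {i} {j} r = begin
    ((suc j ∸ π i j) ⊓ n) ∸ i  ≡⟨ cong (_∸ i) (ℕP.m≤n⇒m⊓n≡m (ℕP.≤-trans (ℕP.m∸n≤m (suc j) (π i j)) (j<n r))) ⟩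
    (suc j ∸ π i j) ∸ i        ≡⟨ ℕP.∸-+-assoc (suc j) (π i j) i ⟩
    suc j ∸ (π i j + i)        ≡⟨ cong (suc j ∸_) (ℕP.+-comm (π i j) i) ⟩
    suc j ∸ (i + π i j)        ≡⟨ sym (ℕP.∸-+-assoc (suc j) i (π i j)) ⟩
    (suc j ∸ i) ∸ π i j        ≡⟨ cong (_∸ π i j) (sym (len-factor i j (j<n r))) ⟩
    len i j ∸ π i j            ∎
    where open ≡-Reasoning

  ∑-covers : ∀ i j k → ℕ∑.∑ (upTo n) (covers i j k) ≡ when (isMR W (i , j)) (when (π i j ≡ᵇ suc k) (len i j ∸ π i j))
  ∑-covers i j k = trans (∑-when (upTo n) (isMR W (i , j)) _) (when-cong (isMR W (i , j)) λ isMR≡true →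
    trans (∑-when (upTo n) (π i j ≡ᵇ suc k) _)
          (cong (when (π i j ≡ᵇ suc k)) (trans (∑-inRange i (suc j ∸ π i j) n) (window-size (isMR⇒IsMaxRep i j isMR≡true)))))

  contribution : ℕ → ℕ → ℚ
  contribution i j = if isMR W (i , j) then (if π i j ≤ᵇ P then exponent (factor W i j) ℚ.- 1ℚ else 0ℚ) else 0ℚ

  contribution-as-∑-covers : ∀ i j →
    contribution i j ≡ ℚ∑.∑ (upTo P) (λ k → (+ ℕ∑.∑ (upTo n) (covers i j k)) / suc k)
  contribution-as-∑-covers i j =
    trans (if-then-0≡∑-when (isMR W (i , j)) _ (λ isMR≡true → exponentTerm-as-∑ (isMR⇒IsMaxRep i j isMR≡true)))
          (ℚ∑.∑-cong (upTo P) (λ k → cong (λ c → (+ c) / suc k) (sym (∑-covers i j k))))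

  covers-pos : ∀ {i j k t} → 1 ≤ covers i j k t → IsMaxRep i j × π i j ≡ suc k × i ≤ t × t + π i j ≤ j
  covers-pos {i} {j} {k} {t} 1≤c with when-pos (isMR W (i , j)) 1≤c
  ... | isMR-T , 1≤c′ with when-pos (π i j ≡ᵇ suc k) 1≤c′
  ... | π≡ᵇ , 1≤ind with inRange-pos i (suc j ∸ π i j) t 1≤ind
  ... | i≤t , t<end =
    r , ℕP.≡ᵇ⇒≡ (π i j) (suc k) π≡ᵇ , i≤t , ℕP.≤-pred (ℕP.m≤o∸n⇒m+n≤o (suc t) (π≤1+j r) t<end)
    where
    r = isMR⇒IsMaxRep i j (≡true isMR-T)

  covers-unique : ∀ {i j i′ j′ k t} → 1 ≤ covers i j k t → 1 ≤ covers i′ j′ k t → i ≡ i′ × j ≡ j′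
  covers-unique {j′ = j′} {t = t} c c′ with covers-pos c | covers-pos c′
  ... | r , π≡ , i≤t , t+π≤j | r′ , π′≡ , i′≤t , t+π′≤j′ =
    maxRep-unique r r′ same i≤t t+π≤j i′≤t (subst (λ Q → t + Q ≤ j′) same t+π′≤j′)
    where same = trans π′≡ (sym π≡)

  private
    ∑ᵤ : (ℕ → ℕ) → ℕ
    ∑ᵤ = ℕ∑.∑ (upTo n)

  ∑∑-covers-≤1 : ∀ k t → ∑ᵤ (λ i → ∑ᵤ (λ j → covers i j k t)) ≤ 1
  ∑∑-covers-≤1 k t = ∑-upTo-≤1 n _ row-≤1 rows-unique
    where
    covers-≤1 : ∀ i j → covers i j k t ≤ 1
    covers-≤1 i j = when-≤1 (isMR W (i , j)) (when-≤1 (π i j ≡ᵇ suc k) (inRange-≤1 i (suc j ∸ π i j) t))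
    row-≤1 : ∀ i → ∑ᵤ (λ j → covers i j k t) ≤ 1
    row-≤1 i = ∑-upTo-≤1 n _ (λ j → covers-≤1 i j) (λ {j} {j′} c c′ → proj₂ (covers-unique {i} {j} {i} {j′} c c′))
    rows-unique : ∀ {i i′} → 1 ≤ ∑ᵤ (λ j → covers i j k t) → 1 ≤ ∑ᵤ (λ j → covers i′ j k t) → i ≡ i′
    rows-unique c c′ with ∑-pos⇒∃ (upTo n) _ c | ∑-pos⇒∃ (upTo n) _ c′
    ... | j , cj | j′ , cj′ = proj₁ (covers-unique {j = j} {j′ = j′} cj cj′)

  ∑∑∑-covers-≤n : ∀ k → ∑ᵤ (λ i → ∑ᵤ (λ j → ∑ᵤ (covers i j k))) ≤ n
  ∑∑∑-covers-≤n k = begin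
    ∑ᵤ (λ i → ∑ᵤ (λ j → ∑ᵤ (covers i j k)))
      ≡⟨ ℕ∑.∑-cong (upTo n) (λ i → ℕ∑.∑-comm (upTo n) (upTo n) (λ j → covers i j k)) ⟩
    ∑ᵤ (λ i → ∑ᵤ (λ t → ∑ᵤ (λ j → covers i j k t)))
      ≡⟨ ℕ∑.∑-comm (upTo n) (upTo n) _ ⟩
    ∑ᵤ (λ t → ∑ᵤ (λ i → ∑ᵤ (λ j → covers i j k t)))
      ≤⟨ ℕ∑.∑-mono-≤ (upTo n) (∑∑-covers-≤1 k) ⟩
    ∑ᵤ (λ _ → 1)
      ≡⟨ trans (ℕ∑.∑-const-1 (upTo n)) (ListP.length-upTo n) ⟩
    n ∎
    where open ℕP.≤-Reasoning

  private
    -- F is kept abstract because sumMR folds with an anonymous pattern-matching lambda.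
    foldr-filter≡∑ : ∀ {A : Set} (b : A → Bool) (v : A → ℚ) {F : A → ℚ → ℚ} →
      (∀ x acc → F x acc ≡ v x ℚ.+ acc) → ∀ xs →
      foldr F 0ℚ (filter (λ x → b x Bool.≟ true) xs) ≡ ℚ∑.∑ xs (λ x → if b x then v x else 0ℚ)
    foldr-filter≡∑ b v hF [] = refl
    foldr-filter≡∑ {A} b v {F} hF (x ∷ xs) = select (b x) refl
      where
      D = λ (y : A) → b y Bool.≟ true
      sel : Bool → ℚ
      sel c = if c then v x else 0ℚ
      rest : ℚ
      rest = ℚ∑.∑ xs (λ y → if b y then v y else 0ℚ)
      select : ∀ c → b x ≡ c →
        foldr F 0ℚ (filter D (x ∷ xs)) ≡ sel (b x) ℚ.+ rest
      select true  bx = begin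
        foldr F 0ℚ (filter D (x ∷ xs))   ≡⟨ cong (foldr F 0ℚ) (ListP.filter-accept D bx) ⟩
        F x (foldr F 0ℚ (filter D xs))   ≡⟨ hF x _ ⟩
        v x ℚ.+ foldr F 0ℚ (filter D xs) ≡⟨ cong₂ ℚ._+_ (cong sel (sym bx)) (foldr-filter≡∑ b v hF xs) ⟩
        sel (b x) ℚ.+ rest               ∎
        where open ≡-Reasoning
      select false bx = begin
        foldr F 0ℚ (filter D (x ∷ xs))   ≡⟨ cong (foldr F 0ℚ) (ListP.filter-reject D bx≢true) ⟩
        foldr F 0ℚ (filter D xs)         ≡⟨ foldr-filter≡∑ b v hF xs ⟩
        rest                             ≡⟨ sym (ℚP.+-identityˡ rest) ⟩
        0ℚ ℚ.+ rest                      ≡⟨ cong (λ c → sel c ℚ.+ rest) (sym bx) ⟩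
        sel (b x) ℚ.+ rest               ∎
        where
        open ≡-Reasoning
        bx≢true : b x ≢ true
        bx≢true bx≡true = contradiction (trans (sym bx) bx≡true) λ ()

    if-+ : ∀ c a acc → (if c then a ℚ.+ acc else acc) ≡ (if c then a else 0ℚ) ℚ.+ acc
    if-+ true  a acc = refl
    if-+ false a acc = sym (ℚP.+-identityˡ acc)

  sumMR-as-∑ : sumMR W P ≡ ℚ∑.∑ (upTo n) (λ i → ℚ∑.∑ (upTo n) (λ j → contribution i j))
  sumMR-as-∑ = trans (foldr-filter≡∑ (isMR W) value (λ r acc → if-+ (π (proj₁ r) (proj₂ r) ≤ᵇ P) _ acc) pairs)
    (trans (ℚ∑.∑-concatMap (λ i → map (i ,_) (upTo n)) (upTo n) _)
           (ℚ∑.∑-cong (upTo n) (λ i → ℚ∑.∑-map (i ,_) (upTo n) _)))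
    where
    value : ℕ × ℕ → ℚ
    value (i , j) = if π i j ≤ᵇ P then exponent (factor W i j) ℚ.- 1ℚ else 0ℚ
    pairs = concatMap (λ i → map (λ j → (i , j)) (upTo n)) (upTo n)

  sumMR-≤ : sumMR W P ℚ.≤ ℚ∑.∑ (upTo P) (λ k → (+ n) / suc k)
  sumMR-≤ = begin
    sumMR W P
      ≡⟨ sumMR-as-∑ ⟩
    ∑ᵢ (λ i → ∑ᵢ (λ j → contribution i j))
      ≡⟨ ℚ∑.∑-cong (upTo n) (λ i → ℚ∑.∑-cong (upTo n) (contribution-as-∑-covers i)) ⟩
    ∑ᵢ (λ i → ∑ᵢ (λ j → ∑ₖ (λ k → c i j k / suc k)))
      ≡⟨ ℚ∑.∑-cong (upTo n) (λ i → ℚ∑.∑-comm (upTo n) (upTo P) (λ j k → c i j k / suc k)) ⟩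
    ∑ᵢ (λ i → ∑ₖ (λ k → ∑ᵢ (λ j → c i j k / suc k)))
      ≡⟨ ℚ∑.∑-comm (upTo n) (upTo P) _ ⟩
    ∑ₖ (λ k → ∑ᵢ (λ i → ∑ᵢ (λ j → c i j k / suc k)))
      ≡⟨ ℚ∑.∑-cong (upTo P) (λ k → trans (ℚ∑.∑-cong (upTo n) (λ i → ℚ∑.∑-/ (upTo n) (λ j → count i j k) (suc k)))
                                          (ℚ∑.∑-/ (upTo n) (λ i → ∑ᵤ (λ j → count i j k)) (suc k))) ⟩
    ∑ₖ (λ k → (+ total k) / suc k)
      ≤⟨ ℚ∑.∑-mono-≤ (upTo P) (λ k → /≤/ (total k) (suc k) n (suc k) (ℕP.*-monoˡ-≤ (suc k) (∑∑∑-covers-≤n k))) ⟩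
    ∑ₖ (λ k → (+ n) / suc k)
      ∎
    where
    open ℚP.≤-Reasoning
    ∑ᵢ ∑ₖ : (ℕ → ℚ) → ℚ
    ∑ᵢ = ℚ∑.∑ (upTo n)
    ∑ₖ = ℚ∑.∑ (upTo P)
    count : ℕ → ℕ → ℕ → ℕ
    count i j k = ∑ᵤ (covers i j k)
    c : ℕ → ℕ → ℕ → ℤ
    c i j k = + count i j k
    total : ℕ → ℕ
    total k = ∑ᵤ (λ i → ∑ᵤ (λ j → count i j k))

open import Data.Integer using (+_)
open import Data.Rational as ℚ using (_/_; 1ℚ)

sumMR/n-≤-harmonic : ∀ {k} (W : List (Fin k)) P .{{_ : ℕ.NonZero (length W)}} →
  sumMR W P ℚ.* ((+ 1) / length W) ℚ.≤ Exponential.harmonic P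
sumMR/n-≤-harmonic W P = begin
  sumMR W P ℚ.* (1/n)
    ≤⟨ ℚP.*-monoʳ-≤-nonNeg (1/n) {{ℚ.nonNegative (Fraction.0≤1/n n)}} (RepetitionSum.sumMR-≤ W P) ⟩
  ℚ∑.∑ (upTo P) (λ k → (+ n) / suc k) ℚ.* (1/n)
    ≡⟨ ℚ∑.∑-*ʳ (upTo P) (λ k → (+ n) / suc k) (1/n) ⟩
  ℚ∑.∑ (upTo P) (λ k → (+ n) / suc k ℚ.* (1/n))
    ≡⟨ ℚ∑.∑-cong (upTo P) (λ k → Fraction./*/≡/ n (suc k) 1 n 1 (suc k) (cross k)) ⟩
  ℚ∑.∑ (upTo P) (λ k → (+ 1) / suc k)
    ∎
  where
  open ℚP.≤-Reasoning
  n = length W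
  1/n = (+ 1) / n
  cross : ∀ k → (n ℕ.* 1) ℕ.* suc k ≡ 1 ℕ.* (suc k ℕ.* n)
  cross k = trans (cong (ℕ._* suc k) (ℕP.*-identityʳ n)) (trans (ℕP.*-comm n (suc k)) (sym (ℕP.*-identityˡ _)))

corollary1 : ∀ (k : ℕ) (w : List (Fin k)) (a : Fin k) (p : ℕ) →
    BoundLn (sumMR (a ∷ w) (suc p)) (length (a ∷ w)) (suc p)
corollary1 k w a p =
  Exponential.≤ln-of-≤harmonic-1 p (ℚP.+-monoˡ-≤ (ℚ.- 1ℚ) (sumMR/n-≤-harmonic (a ∷ w) (suc p)))
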